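{- Let $x=x_1\cdots x_n$ ($n\ge1$) be a primitive modified ascent sequence. Then the set of weak left-to-right maxima of $x$ equals the set of left-to-right maxima of $x$, the set of weak right-to-left maxima of $x$ equals the set of right-to-left maxima of $x$, and the set of left-to-right minima of $x$ is $\{(1,x_1)\}$.
   Context: A Cayley permutation of length $n$ is a word $x=x_1\cdots x_n$ of positive integers whose set of values is $\{1,\dots,k\}$ for some $k\le n$. The ascent tops of $x$ are the pairs $(1,x_1)$ and $(i,x_i)$ with $1<i\le n$ and $x_{i-1}<x_i$; the leftmost copies of $x$ are the pairs $(\min\{i:x_i=j\},j)$ for $1\le j\le\max(x)$. A modified ascent sequence is a Cayley permutation whose set of ascent tops equals its set of leftmost copies; it is primitive if it has no two consecutive equal entries. A left-to-right maximum (resp. weak left-to-right maximum) of $x$ is a pair $(i,x_i)$ with $x_i>x_j$ (resp. $x_i\ge x_j$) for all $j<i$; a left-to-right minimum is a pair $(i,x_i)$ with $x_i<x_j$ for all $j<i$; a right-to-left maximum (resp. weak right-to-left maximum) is a pair $(i,x_i)$ with $x_i>x_j$ (resp. $x_i\ge x_j$) for all $j>i$. -}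

module Defs where

open import Data.Nat using (ℕ; zero; suc; _≤_; _<_; _≥_; _>_)
open import Data.Fin using (Fin; toℕ) renaming (zero to fzero; suc to fsuc)
open import Data.Product using (Σ; ∃; ∃-syntax; _×_; _,_)
open import Data.Sum using (_⊎_)
open import Relation.Binary.PropositionalEquality using (_≡_)
open import Relation.Nullary using (¬_)

-- A word of length n is a function from positions (Fin n, 0-based) to values.
-- Position i : Fin n corresponds to the paper's position toℕ i + 1.
Word : ℕ → Set
Word n = Fin n → ℕ

Pair : ℕ → Set
Pair n = Fin n × ℕ

PairSet : ℕ → Set₁
PairSet n = Pair n → Set

_≐_ : ∀ {n} → PairSet n → PairSet n → Set
A ≐ B = ∀ p → (A p → B p) × (B p → A p)

IsCayley : ∀ {n} → Word n → Set
IsCayley {n} x = ∃[ k ] ((∀ i → 1 ≤ x i × x i ≤ k) × (∀ j → 1 ≤ j → j ≤ k → ∃[ i ] x i ≡ j))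

AscentTop : ∀ {n} → Word n → PairSet n
AscentTop x (i , v) = (v ≡ x i) × ((toℕ i ≡ 0) ⊎ (∃[ j ] (suc (toℕ j) ≡ toℕ i × x j < x i)))

LeftmostCopy : ∀ {n} → Word n → PairSet n
LeftmostCopy x (i , v) = (v ≡ x i) × (∀ j → toℕ j < toℕ i → ¬ (x j ≡ x i))

IsModAscent : ∀ {n} → Word n → Set
IsModAscent x = IsCayley x × (AscentTop x ≐ LeftmostCopy x)

IsPrimitive : ∀ {n} → Word n → Set
IsPrimitive x = ∀ i j → suc (toℕ i) ≡ toℕ j → ¬ (x i ≡ x j)

LRMax : ∀ {n} → Word n → PairSet n
LRMax x (i , v) = (v ≡ x i) × (∀ j → toℕ j < toℕ i → x i > x j)

WeakLRMax : ∀ {n} → Word n → PairSet n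
WeakLRMax x (i , v) = (v ≡ x i) × (∀ j → toℕ j < toℕ i → x i ≥ x j)

LRMin : ∀ {n} → Word n → PairSet n
LRMin x (i , v) = (v ≡ x i) × (∀ j → toℕ j < toℕ i → x i < x j)

RLMax : ∀ {n} → Word n → PairSet n
RLMax x (i , v) = (v ≡ x i) × (∀ j → toℕ i < toℕ j → x i > x j)

WeakRLMax : ∀ {n} → Word n → PairSet n
WeakRLMax x (i , v) = (v ≡ x i) × (∀ j → toℕ i < toℕ j → x i ≥ x j)

Singleton : ∀ {n} → Pair n → PairSet n
Singleton q p = p ≡ q

module Submission where

open import Defs
open import Data.Nat using (ℕ; suc; _≤_; _<_; _<?_; s≤s; z≤n)
open import Data.Nat.Properties
  using (≤-reflexive; <-≤-trans; <⇒≤; <⇒≱; <-asym; <-irrefl; ≤-pred; ≮⇒≥; ≤∧≢⇒<; m≤n⇒m<n∨m≡n; suc-injective; 1+n≢0)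
open import Data.Fin using (Fin; toℕ; inject₁) renaming (zero to fzero; suc to fsuc)
open import Data.Fin.Properties using (toℕ-inject₁; toℕ-injective)
open import Data.Product using (Σ; _×_; _,_; proj₁; proj₂)
open import Data.Sum using (inj₁; inj₂)
open import Data.Empty using (⊥-elim)
open import Relation.Nullary using (yes; no; ¬_)
open import Relation.Binary.PropositionalEquality
  using (_≡_; _≢_; refl; sym; trans; cong; subst; ≢-sym)

-- In a primitive modified ascent sequence every repeated entry is strictly smaller than its
-- left neighbour: it is not a leftmost copy, hence not an ascent top, and it cannot equal its
-- neighbour.  So a weak left-to-right maximum repeating an earlier value would lie below its
-- own left neighbour, and a later repeat of a weak right-to-left maximum would have a left
-- neighbour exceeding that maximum.  Dually, a left-to-right minimum is a leftmost copy, hence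
-- an ascent top, which is impossible after the first position.

LRMax⇒WeakLRMax : ∀ {n} {x : Word n} {q} → LRMax x q → WeakLRMax x q
LRMax⇒WeakLRMax (v≡xi , xj<xi) = v≡xi , λ j j<i → <⇒≤ (xj<xi j j<i)

RLMax⇒WeakRLMax : ∀ {n} {x : Word n} {q} → RLMax x q → WeakRLMax x q
RLMax⇒WeakRLMax (v≡xi , xj<xi) = v≡xi , λ j i<j → <⇒≤ (xj<xi j i<j)

predecessor : ∀ {n m} {i : Fin n} → m < toℕ i → Σ (Fin n) λ p → suc (toℕ p) ≡ toℕ i
predecessor {i = fsuc k} _ = inject₁ k , cong suc (toℕ-inject₁ k)

IsLeftmost : ∀ {n} → Word n → Fin n → Set
IsLeftmost x i = ∀ j → toℕ j < toℕ i → x j ≢ x i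

module _ {n} {x : Word n} (tops≐copies : AscentTop x ≐ LeftmostCopy x) where

  repeat-≤-predecessor : ∀ {i j p : Fin n} → toℕ j < toℕ i → x j ≡ x i →
                         suc (toℕ p) ≡ toℕ i → x i ≤ x p
  repeat-≤-predecessor {i} {j} {p} j<i xj≡xi p+1≡i with x p <? x i
  ... | no xp≮xi = ≮⇒≥ xp≮xi
  ... | yes xp<xi = ⊥-elim (leftmost j j<i xj≡xi)
    where
    leftmost : IsLeftmost x i
    leftmost = proj₂ (proj₁ (tops≐copies (i , x i)) (refl , inj₂ (p , p+1≡i , xp<xi)))

  leftmost-predecessor-< : ∀ {i p : Fin n} → IsLeftmost x i →
                           suc (toℕ p) ≡ toℕ i → x p < x i
  leftmost-predecessor-< {i} {p} leftmost p+1≡i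
    with proj₂ (proj₂ (tops≐copies (i , x i)) (refl , leftmost))
  ... | inj₁ i≡0 = ⊥-elim (1+n≢0 (trans p+1≡i i≡0))
  ... | inj₂ (q , q+1≡i , xq<xi) =
    subst (λ r → x r < x i) (toℕ-injective (suc-injective (trans q+1≡i (sym p+1≡i)))) xq<xi

  module _ (prim : IsPrimitive x) where

    repeat-<-predecessor : ∀ {i j p : Fin n} → toℕ j < toℕ i → x j ≡ x i →
                           suc (toℕ p) ≡ toℕ i → x i < x p
    repeat-<-predecessor {i} {p = p} j<i xj≡xi p+1≡i =
      ≤∧≢⇒< (repeat-≤-predecessor j<i xj≡xi p+1≡i) (≢-sym (prim p i p+1≡i))

    WeakLRMax⇒LRMax : ∀ {q} → WeakLRMax x q → LRMax x q
    WeakLRMax⇒LRMax {i , _} (v≡xi , xj≤xi) = v≡xi , λ j j<i → ≤∧≢⇒< (xj≤xi j j<i) (no-earlier-copy j<i)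
      where
      no-earlier-copy : ∀ {j} → toℕ j < toℕ i → x j ≢ x i
      no-earlier-copy j<i xj≡xi = let (p , p+1≡i) = predecessor j<i in
        <⇒≱ (repeat-<-predecessor j<i xj≡xi p+1≡i) (xj≤xi p (≤-reflexive p+1≡i))

    WeakRLMax⇒RLMax : ∀ {q} → WeakRLMax x q → RLMax x q
    WeakRLMax⇒RLMax {i , _} (v≡xi , xj≤xi) = v≡xi , λ j i<j → ≤∧≢⇒< (xj≤xi j i<j) (no-later-copy i<j)
      where
      weakly-dominates : ∀ {j} → toℕ i ≤ toℕ j → x j ≤ x i
      weakly-dominates i≤j with m≤n⇒m<n∨m≡n i≤j
      ... | inj₁ i<j = xj≤xi _ i<j
      ... | inj₂ i≡j = ≤-reflexive (cong x (toℕ-injective (sym i≡j)))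

      no-later-copy : ∀ {j} → toℕ i < toℕ j → x j ≢ x i
      no-later-copy i<j xj≡xi = let (p , p+1≡j) = predecessor i<j in
        <-irrefl xj≡xi (<-≤-trans (repeat-<-predecessor i<j (sym xj≡xi) p+1≡j)
                                  (weakly-dominates (≤-pred (subst (toℕ i <_) (sym p+1≡j) i<j))))

  LRMin-only-at-start : ∀ {i v} → 0 < toℕ i → ¬ LRMin x (i , v)
  LRMin-only-at-start {i} 0<i (_ , xi<xj) = let (p , p+1≡i) = predecessor 0<i in
    <-asym (leftmost-predecessor-< leftmost p+1≡i) (xi<xj p (≤-reflexive p+1≡i))
    where
    leftmost : IsLeftmost x i
    leftmost j j<i xj≡xi = <-irrefl (sym xj≡xi) (xi<xj j j<i)

lemma2p3 : (m : ℕ) (x : Word (suc m)) → IsModAscent x → IsPrimitive x →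
    (WeakLRMax x ≐ LRMax x) × (WeakRLMax x ≐ RLMax x) × (LRMin x ≐ Singleton (fzero , x fzero))
lemma2p3 m x (_ , tops≐copies) prim =
  (λ _ → WeakLRMax⇒LRMax tops≐copies prim , LRMax⇒WeakLRMax) ,
  (λ _ → WeakRLMax⇒RLMax tops≐copies prim , RLMax⇒WeakRLMax) ,
  (λ q → LRMin-at-start q , λ { refl → refl , λ _ () })
  where
  LRMin-at-start : ∀ q → LRMin x q → Singleton (fzero , x fzero) q
  LRMin-at-start (fzero , _) (refl , _) = refl
  LRMin-at-start (fsuc _ , _) min = ⊥-elim (LRMin-only-at-start tops≐copies (s≤s z≤n) min)
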